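{- Let $k\geq 2$ be an integer and $f_{2^k,n}:=\sum_{j=0}^{n}\binom{n}{j}(-1)^{\binom{j}{2^k}}$. Then the sequence $(f_{2^k,n})_{n}$ is positive and nondecreasing for $0\leq n\leq 2^{k+1}-2$.
   Context: Here $\binom{j}{m}=0$ for $0\le j<m$; $f_{2^k,n}$ is the value at $z=-1$ of $f_{2^k,n}(z)=\sum_{j=0}^{n}\binom{n}{j}z^{\binom{j}{2^k}}$. -}

module Defs where

open import Data.Nat using (ℕ; zero; suc; _^_)
open import Data.Nat.Combinatorics using (_C_)
open import Data.Integer using (ℤ; +_; -_; _+_; _*_)

neg1^ : ℕ → ℤ
neg1^ zero = + 1
neg1^ (suc m) = - neg1^ m

sumTo : ℕ → (ℕ → ℤ) → ℤ
sumTo zero g = g 0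
sumTo (suc n) g = sumTo n g + g (suc n)

f : ℕ → ℕ → ℤ
f m n = sumTo n (λ j → (+ (n C j)) * neg1^ (j C m))

-- Write σ j = (-1)^C(j,m), so that f_{m,n} = Σ_j C(n,j) σ j.  Pascal's rule gives
-- f_{m,n+1} − f_{m,n} = Σ_j C(n,j) σ (j+1), and pairing j with n − j (C(n,j) = C(n,n−j))
-- shows this is ≥ 0 as long as (j+1) + (n−j+1) = n + 2 < 2m: then one of the two indices
-- is < m, where σ = 1, so the paired signs never sum to −2.  Since f_{m,0} = 1, the
-- sequence is positive and nondecreasing for n ≤ 2m − 2; the theorem is the case m = 2^k.
module Submission where

open import Defs
open import Data.Nat using (ℕ; _^_; _∸_; _≤_; suc)
open import Data.Integer using (+_) renaming (_<_ to _<ℤ_; _≤_ to _≤ℤ_)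
open import Data.Product using (_×_)

open import Data.Nat using (zero; z≤n; _<_; _<?_)
import Data.Nat as ℕ
import Data.Nat.Properties as ℕ
open import Data.Nat.Combinatorics using (_C_; k>n⇒nCk≡0; nCk≡nC[n∸k]; nCk+nC[k+1]≡[n+1]C[k+1])
open import Data.Integer using (ℤ; -[1+_]; _+_; _*_; -_; +≤+; +<+)
open import Data.Integer.Properties
  using (+-comm; +-assoc; +-identityʳ; *-distribˡ-+; *-distribʳ-+; *-zeroʳ; *-monoˡ-≤-nonNeg;
         neg-involutive; +-mono-≤; +-monoʳ-≤; <-≤-trans)
open import Data.Integer.Solver using (module +-*-Solver)
open import Data.Sum using (_⊎_; inj₁; inj₂)
open import Data.Product using (_,_)
open import Function using (_∘_)
open import Relation.Binary.PropositionalEquality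
open import Relation.Nullary using (yes; no)
open import Relation.Nullary.Negation using (contradiction)

0≤i+i⇒0≤i : ∀ {i} → + 0 ≤ℤ i + i → + 0 ≤ℤ i
0≤i+i⇒0≤i {+ n}      _  = +≤+ z≤n
0≤i+i⇒0≤i { -[1+ n ]} ()

sumTo-cong : ∀ n {a b : ℕ → ℤ} → (∀ j → j ≤ n → a j ≡ b j) → sumTo n a ≡ sumTo n b
sumTo-cong zero    eq = eq 0 z≤n
sumTo-cong (suc n) eq =
  cong₂ _+_ (sumTo-cong n (λ j j≤n → eq j (ℕ.m≤n⇒m≤1+n j≤n))) (eq (suc n) ℕ.≤-refl)

sumTo-+ : ∀ n (a b : ℕ → ℤ) → sumTo n a + sumTo n b ≡ sumTo n (λ j → a j + b j)
sumTo-+ zero    a b = refl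
sumTo-+ (suc n) a b = begin
  (sumTo n a + a (suc n)) + (sumTo n b + b (suc n))
    ≡⟨ +-interchange (sumTo n a) (a (suc n)) (sumTo n b) (b (suc n)) ⟩
  (sumTo n a + sumTo n b) + (a (suc n) + b (suc n))
    ≡⟨ cong (_+ (a (suc n) + b (suc n))) (sumTo-+ n a b) ⟩
  sumTo n (λ j → a j + b j) + (a (suc n) + b (suc n)) ∎
  where
    open ≡-Reasoning
    +-interchange : ∀ w x y z → (w + x) + (y + z) ≡ (w + y) + (x + z)
    +-interchange = solve 4 (λ w x y z → (w :+ x) :+ (y :+ z) := (w :+ y) :+ (x :+ z)) refl
      where open +-*-Solver

sumTo-head : ∀ n (a : ℕ → ℤ) → sumTo (suc n) a ≡ a 0 + sumTo n (a ∘ suc)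
sumTo-head zero    a = refl
sumTo-head (suc n) a =
  trans (cong (_+ a (suc (suc n))) (sumTo-head n a)) (+-assoc (a 0) _ _)

sumTo-reverse : ∀ n (a : ℕ → ℤ) → sumTo n a ≡ sumTo n (λ j → a (n ∸ j))
sumTo-reverse zero    a = refl
sumTo-reverse (suc n) a = begin
  sumTo n a + a (suc n)                   ≡⟨ cong (_+ a (suc n)) (sumTo-reverse n a) ⟩
  sumTo n (λ j → a (n ∸ j)) + a (suc n)   ≡⟨ +-comm _ (a (suc n)) ⟩
  a (suc n) + sumTo n (λ j → a (n ∸ j))   ≡⟨ sym (sumTo-head n (λ j → a (suc n ∸ j))) ⟩
  sumTo (suc n) (λ j → a (suc n ∸ j))     ∎
  where open ≡-Reasoning

sumTo-nonneg : ∀ n {a : ℕ → ℤ} → (∀ j → j ≤ n → + 0 ≤ℤ a j) → + 0 ≤ℤ sumTo n a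
sumTo-nonneg zero    0≤a = 0≤a 0 z≤n
sumTo-nonneg (suc n) 0≤a =
  +-mono-≤ (sumTo-nonneg n (λ j j≤n → 0≤a j (ℕ.m≤n⇒m≤1+n j≤n))) (0≤a (suc n) ℕ.≤-refl)

sumTo-nonneg-paired : ∀ n (a : ℕ → ℤ) → (∀ j → j ≤ n → + 0 ≤ℤ a j + a (n ∸ j)) →
                      + 0 ≤ℤ sumTo n a
sumTo-nonneg-paired n a 0≤pair = 0≤i+i⇒0≤i (subst (+ 0 ≤ℤ_) (sym doubled) (sumTo-nonneg n 0≤pair))
  where
    doubled : sumTo n a + sumTo n a ≡ sumTo n (λ j → a j + a (n ∸ j))
    doubled = trans (cong (λ s → sumTo n a + s) (sumTo-reverse n a)) (sumTo-+ n a _)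

binomialSum : (ℕ → ℤ) → ℕ → ℤ
binomialSum σ n = sumTo n (λ j → + (n C j) * σ j)

binomialSum-pascal : ∀ σ n → binomialSum σ (suc n) ≡ binomialSum σ n + binomialSum (σ ∘ suc) n
binomialSum-pascal σ n = begin
  binomialSum σ (suc n)
    ≡⟨ sumTo-head n _ ⟩
  + 1 * σ 0 + sumTo n (λ j → + (suc n C suc j) * σ (suc j))
    ≡⟨ cong (λ s → + 1 * σ 0 + s) (sumTo-cong n (λ j _ → pascal j)) ⟩
  + 1 * σ 0 + sumTo n (λ j → shifted j + upper j)
    ≡⟨ cong (λ s → + 1 * σ 0 + s) (sym (sumTo-+ n shifted upper)) ⟩
  + 1 * σ 0 + (binomialSum (σ ∘ suc) n + sumTo n upper)
    ≡⟨ rearrange (+ 1 * σ 0) (binomialSum (σ ∘ suc) n) (sumTo n upper) ⟩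
  (+ 1 * σ 0 + sumTo n upper) + binomialSum (σ ∘ suc) n
    ≡⟨ cong (_+ binomialSum (σ ∘ suc) n) (sym unshifted) ⟩
  binomialSum σ n + binomialSum (σ ∘ suc) n ∎
  where
    open ≡-Reasoning
    shifted upper : ℕ → ℤ
    shifted j = + (n C j) * σ (suc j)
    upper   j = + (n C suc j) * σ (suc j)

    pascal : ∀ j → + (suc n C suc j) * σ (suc j) ≡ shifted j + upper j
    pascal j = begin
      + (suc n C suc j) * σ (suc j)
        ≡⟨ cong (λ c → + c * σ (suc j)) (sym (nCk+nC[k+1]≡[n+1]C[k+1] n j)) ⟩
      + (n C j ℕ.+ n C suc j) * σ (suc j)
        ≡⟨ *-distribʳ-+ (σ (suc j)) (+ (n C j)) (+ (n C suc j)) ⟩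
      shifted j + upper j ∎

    -- append the vanishing term C(n, n+1) σ (n+1), then split off j = 0
    unshifted : binomialSum σ n ≡ + 1 * σ 0 + sumTo n upper
    unshifted = begin
      binomialSum σ n
        ≡⟨ sym (+-identityʳ _) ⟩
      binomialSum σ n + + 0
        ≡⟨ cong (λ c → binomialSum σ n + + c * σ (suc n)) (sym (k>n⇒nCk≡0 (ℕ.n<1+n n))) ⟩
      sumTo (suc n) (λ j → + (n C j) * σ j)
        ≡⟨ sumTo-head n _ ⟩
      + 1 * σ 0 + sumTo n upper ∎

    rearrange : ∀ x y z → x + (y + z) ≡ (x + z) + y
    rearrange = solve 3 (λ x y z → x :+ (y :+ z) := (x :+ z) :+ y) refl
      where open +-*-Solver

binomialSum-nonneg-paired : ∀ σ n → (∀ j → j ≤ n → + 0 ≤ℤ σ j + σ (n ∸ j)) →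
                            + 0 ≤ℤ binomialSum σ n
binomialSum-nonneg-paired σ n 0≤pair = sumTo-nonneg-paired n _ 0≤term-pair
  where
    0≤term-pair : ∀ j → j ≤ n → + 0 ≤ℤ + (n C j) * σ j + + (n C (n ∸ j)) * σ (n ∸ j)
    0≤term-pair j j≤n
      rewrite sym (nCk≡nC[n∸k] j≤n) | sym (*-distribˡ-+ (+ (n C j)) (σ j) (σ (n ∸ j))) =
      subst (_≤ℤ + (n C j) * (σ j + σ (n ∸ j))) (*-zeroʳ (+ (n C j)))
            (*-monoˡ-≤-nonNeg (+ (n C j)) (0≤pair j j≤n))

neg1^≡±1 : ∀ x → neg1^ x ≡ + 1 ⊎ neg1^ x ≡ - + 1
neg1^≡±1 zero    = inj₁ refl
neg1^≡±1 (suc x) with neg1^≡±1 x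
... | inj₁ eq = inj₂ (cong -_ eq)
... | inj₂ eq = inj₁ (trans (cong -_ eq) (neg-involutive (+ 1)))

0≤1+neg1^ : ∀ x → + 0 ≤ℤ + 1 + neg1^ x
0≤1+neg1^ x with neg1^≡±1 x
... | inj₁ eq rewrite eq = +≤+ z≤n
... | inj₂ eq rewrite eq = +≤+ z≤n

module _ (m : ℕ) where

  σ : ℕ → ℤ
  σ j = neg1^ (j C m)

  σ-below : ∀ {j} → j < m → σ j ≡ + 1
  σ-below j<m = cong neg1^ (k>n⇒nCk≡0 j<m)

  σ+σ-nonneg : ∀ a b → a ℕ.+ b < 2 ℕ.* m → + 0 ≤ℤ σ a + σ b
  σ+σ-nonneg a b a+b<2m with a <? m | b <? m
  ... | yes a<m | _       rewrite σ-below a<m = 0≤1+neg1^ (b C m)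
  ... | no  _   | yes b<m rewrite σ-below b<m = subst (+ 0 ≤ℤ_) (+-comm (+ 1) (σ a)) (0≤1+neg1^ (a C m))
  ... | no  a≮m | no  b≮m =
    contradiction (subst (_≤ a ℕ.+ b) (cong (m ℕ.+_) (sym (ℕ.+-identityʳ m)))
                         (ℕ.+-mono-≤ (ℕ.≮⇒≥ a≮m) (ℕ.≮⇒≥ b≮m)))
                  (ℕ.<⇒≱ a+b<2m)

  f-mono : ∀ n → suc (suc n) < 2 ℕ.* m → f m n ≤ℤ f m (suc n)
  f-mono n n+2<2m =
    subst (f m n ≤ℤ_) (sym (binomialSum-pascal σ n))
      (subst (_≤ℤ f m n + binomialSum (σ ∘ suc) n) (+-identityʳ (f m n))
        (+-monoʳ-≤ (f m n) (binomialSum-nonneg-paired (σ ∘ suc) n 0≤pair)))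
    where
      0≤pair : ∀ j → j ≤ n → + 0 ≤ℤ σ (suc j) + σ (suc (n ∸ j))
      0≤pair j j≤n = σ+σ-nonneg (suc j) (suc (n ∸ j)) (subst (_< 2 ℕ.* m) (sym indices-sum) n+2<2m)
        where
          indices-sum : suc j ℕ.+ suc (n ∸ j) ≡ suc (suc n)
          indices-sum = trans (cong suc (ℕ.+-suc j (n ∸ j))) (cong (suc ∘ suc) (ℕ.m+[n∸m]≡n j≤n))

  f-pos : 0 < m → ∀ n → suc n < 2 ℕ.* m → + 0 <ℤ f m n
  f-pos 0<m zero    _       = subst (+ 0 <ℤ_) (sym (cong (λ s → + 1 * s) (σ-below 0<m))) (+<+ (ℕ.s≤s z≤n))
  f-pos 0<m (suc n) n+2<2m = <-≤-trans (f-pos 0<m n (ℕ.<⇒≤ n+2<2m)) (f-mono n n+2<2m)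

≤2m∸2⇒<2m : ∀ {m n} → 0 < m → n ≤ 2 ℕ.* m ∸ 2 → suc n < 2 ℕ.* m
≤2m∸2⇒<2m {m} {n} 0<m n≤2m∸2 =
  subst (_≤ 2 ℕ.* m) (ℕ.+-comm n 2) (ℕ.m≤o∸n⇒m+n≤o n (ℕ.*-monoʳ-≤ 2 0<m) n≤2m∸2)

proposition5p7 : (k : ℕ) → 2 ≤ k → (n : ℕ) → n ≤ 2 ^ (suc k) ∸ 2 →
    (+ 0 <ℤ f (2 ^ k) n) × (suc n ≤ 2 ^ (suc k) ∸ 2 → f (2 ^ k) n ≤ℤ f (2 ^ k) (suc n))
proposition5p7 k _ n n≤2m∸2 =
  f-pos (2 ^ k) 0<2^k n (≤2m∸2⇒<2m 0<2^k n≤2m∸2) ,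
  λ n+1≤2m∸2 → f-mono (2 ^ k) n (≤2m∸2⇒<2m 0<2^k n+1≤2m∸2)
  where
    0<2^k : 0 < 2 ^ k
    0<2^k = ℕ.m^n>0 2 k
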